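{- Let $t\in\mathbb N$, $G$ a graph, $L\subseteq V(G)$ linearly ordered, and $\mathcal P,\mathcal Q$ two pure $L$-linkages of size $4t$ such that $\mathcal P\cup\mathcal Q$ is an $L$-linkage of size $8t$. Then there exist pure linkages $\mathcal P'\subseteq\mathcal P$ and $\mathcal Q'\subseteq\mathcal Q$ of size $t$ such that: - $I_{\mathcal P'}$ and $I_{\mathcal Q'}$ are disjoint if $\mathcal P,\mathcal Q$ are both in series; - $I_{\mathcal P'}$ is disjoint from $I^\ell_{\mathcal Q'}\cup I^r_{\mathcal Q'}$ if $\mathcal P$ is in series and $\mathcal Q$ is not in series; - $I_{\mathcal Q'}$ is disjoint from $I^\ell_{\mathcal P'}\cup I^r_{\mathcal P'}$ if $\mathcal Q$ is in series and $\mathcal P$ is not in series; - $I^\ell_{\mathcal P'},I^r_{\mathcal P'},I^\ell_{\mathcal Q'},I^r_{\mathcal Q'}$ are pairwise disjoint if neither $\mathcal P$ nor $\mathcal Q$ is in series.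
   Context: For a linearly ordered $L\subseteq V(G)$, an $L$-path is a path with at least one edge whose ends lie in $L$ and which is otherwise disjoint from $L$; its smaller end is its left endpoint, its larger end its right endpoint. An $L$-linkage is a family of pairwise disjoint $L$-paths. Two disjoint $L$-paths with ends $p_1<p_2$, $q_1<q_2$, $p_1<q_1$ are in series if $p_2<q_1$, nested if $p_1<q_1<q_2<p_2$, crossing if $p_1<q_1<p_2<q_2$; a linkage is in series/nested/crossing if every pair is, and pure if it is one of these. An interval is $[x,y]=\{z\in L:x\le z\le y\}$. For a linkage $\mathcal P$, $I_{\mathcal P}$ is the minimal interval containing all endpoints of its paths, and $I^\ell_{\mathcal P}$, $I^r_{\mathcal P}$ are the minimal intervals containing all left endpoints, resp. all right endpoints. -}

module Defs where

open import Data.Nat using (ℕ; _+_)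
open import Data.Fin using (Fin; splitAt)
open import Data.Sum using (_⊎_; [_,_])
open import Data.Product using (Σ; ∃; ∃-syntax; _×_; _,_)
open import Data.Empty using (⊥)
open import Data.List using (List; []; _∷_; _++_)
open import Data.List.Membership.Propositional using (_∈_)
open import Data.List.Relation.Unary.All using (All)
open import Data.List.Relation.Unary.Linked using (Linked)
open import Data.List.Relation.Unary.Unique.Propositional using (Unique)
open import Relation.Binary.PropositionalEquality using (_≡_; _≢_)
open import Relation.Binary.Structures using (IsStrictTotalOrder)
open import Relation.Nullary using (¬_)
open import Function.Definitions using (Injective)
open import Function using (_∘_)

record Graph : Set₁ where
  field
    V      : Set
    E      : V → V → Set
    E-sym  : ∀ {u v} → E u v → E v u
    E-irr  : ∀ {v} → ¬ E v v

record OrderedSubset (G : Graph) : Set₁ where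
  field
    L     : Set
    _<_   : L → L → Set
    isSTO : IsStrictTotalOrder _≡_ _<_
    ι     : L → Graph.V G
    ι-inj : Injective _≡_ _≡_ ι

module Linkages (G : Graph) (O : OrderedSubset G) where
  open Graph G
  open OrderedSubset O

  _≤_ : L → L → Set
  x ≤ y = x < y ⊎ x ≡ y

  -- An L-path, written canonically from its smaller end (left) to its
  -- larger end (right); its vertex sequence is ι left, inner..., ι right.
  record LPath : Set where
    field
      left      : L
      right     : L
      inner     : List V
      left<right : left < right
      adjacent  : Linked E (ι left ∷ inner ++ ι right ∷ [])
      distinct  : Unique (ι left ∷ inner ++ ι right ∷ [])
      avoidsL   : All (λ v → ∀ x → ι x ≢ v) inner
  open LPath public

  verts : LPath → List V
  verts p = ι (left p) ∷ inner p ++ ι (right p) ∷ []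

  DisjointPaths : LPath → LPath → Set
  DisjointPaths p q = ∀ v → v ∈ verts p → v ∈ verts q → ⊥

  InSeries Nested Crossing : LPath → LPath → Set
  InSeries p q = right p < left q ⊎ right q < left p
  Nested p q = (left p < left q × right q < right p)
             ⊎ (left q < left p × right p < right q)
  Crossing p q = (left p < left q × left q < right p × right p < right q)
               ⊎ (left q < left p × left p < right q × right q < right p)

  Family : ℕ → Set
  Family m = Fin m → LPath

  IsLinkage : ∀ {m} → Family m → Set
  IsLinkage {m} P = ∀ (i j : Fin m) → i ≢ j → DisjointPaths (P i) (P j)

  AllPairs : ∀ {m} → (LPath → LPath → Set) → Family m → Set
  AllPairs {m} R P = ∀ (i j : Fin m) → i ≢ j → R (P i) (P j)

  SeriesL NestedL CrossingL Pure : ∀ {m} → Family m → Set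
  SeriesL = AllPairs InSeries
  NestedL = AllPairs Nested
  CrossingL = AllPairs Crossing
  Pure P = SeriesL P ⊎ NestedL P ⊎ CrossingL P

  _∪_ : ∀ {m n} → Family m → Family n → Family (m + n)
  _∪_ {m} P Q = [ P , Q ] ∘ splitAt m

  SubFamily : ∀ {k m} → Family k → Family m → Set
  SubFamily {k} {m} P' P =
    Σ (Fin k → Fin m) λ f → Injective _≡_ _≡_ f × (∀ i → P' i ≡ P (f i))

  -- the minimal interval containing a set S of elements of L
  -- (membership: z lies between two elements of S)
  Hull : (L → Set) → L → Set
  Hull S z = ∃[ x ] ∃[ y ] (S x × S y × x ≤ z × z ≤ y)

  I I-left I-right : ∀ {m} → Family m → L → Set
  I {m} P = Hull (λ x → ∃[ i ] (x ≡ left (P i) ⊎ x ≡ right (P i)))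
  I-left {m} P = Hull (λ x → ∃[ i ] (x ≡ left (P i)))
  I-right {m} P = Hull (λ x → ∃[ i ] (x ≡ right (P i)))

  Disjoint : (L → Set) → (L → Set) → Set
  Disjoint A B = ∀ z → A z → B z → ⊥

  _∪ˢ_ : (L → Set) → (L → Set) → L → Set
  (A ∪ˢ B) z = A z ⊎ B z

module Submission where

-- Sort each linkage by left endpoint and cut it into four
-- consecutive blocks of t paths.  Attach to every block one interval if the
-- linkage is in series (the hull of all its endpoints), and two intervals
-- otherwise (the hulls of its left and of its right endpoints).  Because the
-- linkage is pure, the intervals attached to P are pairwise apart, and so are
-- those attached to Q; this gives at most 8 + 8 intervals.  A charging
-- argument then finds a block of P and a block of Q whose intervals do not
-- meet at all: if every one of the 16 block pairs had two meeting intervals,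
-- charge the pair to the interval whose right end lies inside the other one;
-- a charged interval determines its block pair (the other family is apart)
-- and the interval with the largest right end is never charged, so 16
-- pairs would be charged injectively to at most 15 intervals.  (For t = 0
-- the empty subfamilies satisfy everything vacuously.)

open import Defs
open import Data.Nat using (ℕ; _*_; _+_)
open import Data.Product using (Σ; _×_)
open import Relation.Nullary using (¬_)
open import Data.Nat using (zero; suc)
import Data.Nat as ℕ
import Data.Nat.Properties as ℕ
open import Data.Fin as Fin using (Fin; zero; suc; punchIn; punchOut; combine; _↑ˡ_; _↑ʳ_; splitAt)
open import Data.Fin.Properties
  using (_≟_; <-cmp; any?; all?; ¬∀⟶∃¬; +↔⊎; *↔×; injective⇒≤; punchOut-injective;
         punchIn-injective; punchInᵢ≢i; combine-injective; combine-monoˡ-<; splitAt-↑ˡ;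
         splitAt-↑ʳ; <⇒≢)
open import Data.Product using (∃; ∃-syntax; _,_; proj₁; proj₂)
open import Data.Sum using (_⊎_; inj₁; inj₂; [_,_])
open import Data.Sum.Function.Propositional using (_⊎-↔_)
open import Data.Empty using (⊥; ⊥-elim)
open import Data.List.Relation.Unary.Any using (here; there)
open import Data.List.Membership.Propositional using (_∈_)
open import Data.List.Membership.Propositional.Properties using (∈-++⁺ʳ)
open import Function using (_∘_; _↔_; Inverse; Injection)
open import Function.Properties.Inverse using (↔-trans; ↔-sym; ↔⇒↣)
open import Relation.Binary.Definitions using (Reflexive; Transitive; Total; tri<; tri≈; tri>)
open import Relation.Binary.PropositionalEquality using (_≡_; _≢_; refl; sym; trans; cong; subst)
open import Relation.Binary.Structures using (IsStrictTotalOrder)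
open import Relation.Nullary using (Dec; yes; no)
open import Relation.Nullary.Decidable using (_×-dec_)
import Relation.Binary.Construct.StrictToNonStrict as StrictToNonStrict

least : ∀ {A : Set} {R : A → A → Set} → Reflexive R → Transitive R → Total R →
        ∀ {n} (f : Fin (suc n) → A) → ∃[ z ] (∀ k → R (f z) (f k))
least R-refl R-trans R-total {zero} f = zero , λ { zero → R-refl }
least R-refl R-trans R-total {suc n} f with least R-refl R-trans R-total (f ∘ suc)
... | z , z-least with R-total (f zero) (f (suc z))
... | inj₁ f0≤fz = zero , λ { zero → R-refl ; (suc k) → R-trans f0≤fz (z-least k) }
... | inj₂ fz≤f0 = suc z , λ { zero → fz≤f0 ; (suc k) → z-least k }

module OrderedIntervals {L : Set} {_<_ : L → L → Set} (sto : IsStrictTotalOrder _≡_ _<_) where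
  open IsStrictTotalOrder sto using (compare; irrefl; isEquivalence; <-resp-≈)
    renaming (trans to <-trans)
  open StrictToNonStrict _≡_ _<_ public using (_≤_)
  private module NS = StrictToNonStrict _≡_ _<_

  <-irr : ∀ {x} → ¬ (x < x)
  <-irr = irrefl refl

  <-asym : ∀ {x y} → x < y → ¬ (y < x)
  <-asym x<y y<x = <-irr (<-trans x<y y<x)

  ≤-refl : ∀ {x} → x ≤ x
  ≤-refl = inj₂ refl

  ≤-trans : ∀ {x y z} → x ≤ y → y ≤ z → x ≤ z
  ≤-trans = NS.trans isEquivalence <-resp-≈ <-trans

  <-≤-trans : ∀ {x y z} → x < y → y ≤ z → x < z
  <-≤-trans = NS.<-≤-trans <-trans (proj₁ <-resp-≈)

  <⇒≱ : ∀ {x y} → x < y → ¬ (y ≤ x)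
  <⇒≱ x<y y≤x = <-irr (<-≤-trans x<y y≤x)

  argmin : ∀ {n} (f : Fin (suc n) → L) → ∃[ z ] (∀ k → f z ≤ f k)
  argmin = least ≤-refl ≤-trans (NS.total compare)

  argmax : ∀ {n} (f : Fin (suc n) → L) → ∃[ z ] (∀ k → f k ≤ f z)
  argmax = least {R = λ x y → y ≤ x} ≤-refl (λ y≥x z≥y → ≤-trans z≥y y≥x)
                 (λ x y → NS.total compare y x)

  sortedBy : ∀ n (key : Fin n → L) → (∀ a b → a ≢ b → key a ≢ key b) →
             Σ (Fin n → Fin n) λ σ → ∀ a b → a Fin.< b → key (σ a) < key (σ b)
  sortedBy zero key distinct = (λ ()) , λ ()
  sortedBy (suc n) key distinct with argmin key
  ... | z , z-least
      with sortedBy n (key ∘ punchIn z)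
             (λ a b a≢b → distinct _ _ (a≢b ∘ punchIn-injective z a b))
  ... | σ , σ-increasing = τ , τ-increasing
    where
    τ : Fin (suc n) → Fin (suc n)
    τ zero = z
    τ (suc a) = punchIn z (σ a)

    τ-increasing : ∀ a b → a Fin.< b → key (τ a) < key (τ b)
    τ-increasing zero (suc b) _ with z-least (punchIn z (σ b))
    ... | inj₁ smaller = smaller
    ... | inj₂ same = ⊥-elim (distinct _ _ (punchInᵢ≢i z (σ b) ∘ sym) same)
    τ-increasing (suc a) (suc b) (ℕ.s≤s a<b) = σ-increasing a b a<b

  increasing⇒injective : ∀ {n} (key : Fin n → L) (σ : Fin n → Fin n) →
    (∀ a b → a Fin.< b → key (σ a) < key (σ b)) → ∀ {a b} → σ a ≡ σ b → a ≡ b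
  increasing⇒injective key σ increasing {a} {b} σa≡σb with <-cmp a b
  ... | tri< a<b _ _ = ⊥-elim (<-irr (subst (λ c → key (σ a) < key c) (sym σa≡σb) (increasing a b a<b)))
  ... | tri≈ _ a≡b _ = a≡b
  ... | tri> _ _ b<a = ⊥-elim (<-irr (subst (λ c → key (σ b) < key c) σa≡σb (increasing b a b<a)))

  record Interval : Set where
    constructor ⟦_,_⟧
    field
      lo hi : L
  open Interval public

  _∈ᴵ_ : L → Interval → Set
  z ∈ᴵ X = lo X ≤ z × z ≤ hi X

  Overlap Apart : Interval → Interval → Set
  Overlap X Y = lo X ≤ hi Y × lo Y ≤ hi X
  Apart X Y = hi X < lo Y ⊎ hi Y < lo X

  record _↗_ (A B : Interval) : Set where
    constructor inside
    field
      reaches : lo B ≤ hi A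
      ends-before : hi A < hi B

  overlap? : ∀ X Y → Dec (Overlap X Y)
  overlap? X Y = NS.decidable′ compare (lo X) (hi Y) ×-dec NS.decidable′ compare (lo Y) (hi X)

  common-point⇒overlap : ∀ {z X Y} → z ∈ᴵ X → z ∈ᴵ Y → Overlap X Y
  common-point⇒overlap (X≤z , z≤X) (Y≤z , z≤Y) = ≤-trans X≤z z≤Y , ≤-trans Y≤z z≤X

  overlap⇒↗ : ∀ {A B} → Overlap A B → hi A ≢ hi B → A ↗ B ⊎ B ↗ A
  overlap⇒↗ {A} {B} (A≤B , B≤A) hi≢ with compare (hi A) (hi B)
  ... | tri< A<B _ _ = inj₁ (inside B≤A A<B)
  ... | tri≈ _ A≡B _ = ⊥-elim (hi≢ A≡B)
  ... | tri> _ _ B<A = inj₂ (inside A≤B B<A)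

  ↗-not-apart : ∀ {A B B′} → A ↗ B → A ↗ B′ → ¬ Apart B B′
  ↗-not-apart (inside B≤A A<B) (inside B′≤A A<B′) (inj₁ B<B′) = <-irr (<-trans A<B (<-≤-trans B<B′ B′≤A))
  ↗-not-apart (inside B≤A A<B) (inside B′≤A A<B′) (inj₂ B′<B) = <-irr (<-trans A<B′ (<-≤-trans B′<B B≤A))

  Separated : ∀ {m w} → (Fin m → Fin w → Interval) → Set
  Separated Z = ∀ i p i′ p′ → (i , p) ≢ (i′ , p′) → Apart (Z i p) (Z i′ p′)

  apart-sym : ∀ {X Y} → Apart X Y → Apart Y X
  apart-sym = [ inj₂ , inj₁ ]

  apart-from-ordered : ∀ {m} (Z : Fin m → Interval) →
    (∀ {i i′} → i Fin.< i′ → Apart (Z i) (Z i′)) → ∀ i i′ → i ≢ i′ → Apart (Z i) (Z i′)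
  apart-from-ordered Z ordered i i′ i≢i′ with <-cmp i i′
  ... | tri< i<i′ _ _ = ordered i<i′
  ... | tri≈ _ i≡i′ _ = ⊥-elim (i≢i′ i≡i′)
  ... | tri> _ _ i′<i = apart-sym (ordered i′<i)

  ↗-same-block : ∀ {m w} (Z : Fin m → Fin w → Interval) → Separated Z →
    ∀ {A j q j′ q′} → A ↗ Z j q → A ↗ Z j′ q′ → j ≡ j′
  ↗-same-block Z separated {j = j} {q} {j′} {q′} A↗Z A↗Z′ with j ≟ j′
  ... | yes j≡j′ = j≡j′
  ... | no j≢j′ = ⊥-elim (↗-not-apart A↗Z A↗Z′ (separated j q j′ q′ (j≢j′ ∘ cong proj₁)))

  module BlockCounting {m a n b : ℕ}
    (X : Fin (suc m) → Fin (suc a) → Interval) (Y : Fin n → Fin (suc b) → Interval)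
    (X-separated : Separated X) (Y-separated : Separated Y)
    (right-ends-distinct : ∀ i p j q → hi (X i p) ≢ hi (Y j q)) where

    BlocksMeet : Fin (suc m) → Fin n → Set
    BlocksMeet i j = ∃[ p ] ∃[ q ] Overlap (X i p) (Y j q)

    Slot : Set
    Slot = (Fin (suc m) × Fin (suc a)) ⊎ (Fin n × Fin (suc b))

    interval : Slot → Interval
    interval (inj₁ (i , p)) = X i p
    interval (inj₂ (j , q)) = Y j q

    Charged : Fin (suc m) → Fin n → Slot → Set
    Charged i j (inj₁ (i′ , p)) = i′ ≡ i × ∃[ q ] (X i′ p ↗ Y j q)
    Charged i j (inj₂ (j′ , q)) = j′ ≡ j × ∃[ p ] (Y j′ q ↗ X i p)

    charge : ∀ {i j} → BlocksMeet i j → Σ Slot (Charged i j)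
    charge {i} {j} (p , q , meet) with overlap⇒↗ meet (right-ends-distinct i p j q)
    ... | inj₁ X↗Y = inj₁ (i , p) , refl , q , X↗Y
    ... | inj₂ Y↗X = inj₂ (j , q) , refl , p , Y↗X

    charged-unique : ∀ {i j i′ j′} e → Charged i j e → Charged i′ j′ e → (i , j) ≡ (i′ , j′)
    charged-unique (inj₁ _) (refl , _ , X↗Y) (refl , _ , X↗Y′)
      rewrite ↗-same-block Y Y-separated X↗Y X↗Y′ = refl
    charged-unique (inj₂ _) (refl , _ , Y↗X) (refl , _ , Y↗X′)
      rewrite ↗-same-block X X-separated Y↗X Y↗X′ = refl

    charged-below : ∀ {i j} e → Charged i j e → ∃[ e′ ] (hi (interval e) < hi (interval e′))
    charged-below (inj₁ _) (_ , q , inside _ below) = inj₂ (_ , q) , below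
    charged-below (inj₂ _) (_ , p , inside _ below) = inj₁ (_ , p) , below

    N : ℕ
    N = suc m * suc a + n * suc b

    slots : Fin N ↔ Slot
    slots = ↔-trans +↔⊎ (*↔× ⊎-↔ *↔×)
    open Inverse slots using (to; from; strictlyInverseˡ)

    from-injective : ∀ {e e′} → from e ≡ from e′ → e ≡ e′
    from-injective = Injection.injective (↔⇒↣ (↔-sym slots))

    topSlot : Slot
    topSlot = to (proj₁ (argmax (hi ∘ interval ∘ to)))

    below-top : ∀ e → hi (interval e) ≤ hi (interval topSlot)
    below-top e = subst (λ e′ → hi (interval e′) ≤ hi (interval topSlot))
                        (strictlyInverseˡ e) (proj₂ (argmax (hi ∘ interval ∘ to)) (from e))

    charged-not-top : ∀ {i j} e → Charged i j e → e ≢ topSlot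
    charged-not-top e charged refl with charged-below e charged
    ... | e′ , below = <⇒≱ below (below-top e′)

    -- If all block pairs meet, charging is an injection from the block pairs
    -- into the slots other than the top one, of which there are too few.
    all-meet-impossible : N ℕ.≤ suc m * n → ¬ (∀ i j → BlocksMeet i j)
    all-meet-impossible bound allMeet =
      ℕ.<-irrefl refl (ℕ.≤-trans bound (injective⇒≤ code-injective))
      where
      pair : Fin (suc m * n) → Fin (suc m) × Fin n
      pair = Inverse.to *↔×

      charged : (k : Fin (suc m * n)) → Σ Slot (Charged (proj₁ (pair k)) (proj₂ (pair k)))
      charged k = charge (allMeet (proj₁ (pair k)) (proj₂ (pair k)))

      code : Fin (suc m * n) → Fin (ℕ.pred N)
      code k = punchOut {i = from topSlot} {j = from (proj₁ (charged k))}
                 (λ same → charged-not-top _ (proj₂ (charged k)) (sym (from-injective same)))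

      code-injective : ∀ {k k′} → code k ≡ code k′ → k ≡ k′
      code-injective {k} {k′} same =
        Injection.injective (↔⇒↣ *↔×)
          (charged-unique _ (proj₂ (charged k))
            (subst (Charged _ _) (sym (from-injective (punchOut-injective {i = from topSlot} _ _ same)))
                   (proj₂ (charged k′))))

    meet? : ∀ i j → Dec (BlocksMeet i j)
    meet? i j = any? (λ p → any? (λ q → overlap? (X i p) (Y j q)))

    blocks-avoid : N ℕ.≤ suc m * n → ∃[ i ] ∃[ j ] ¬ BlocksMeet i j
    blocks-avoid bound with ¬∀⟶∃¬ _ _ (λ i → all? (meet? i)) (all-meet-impossible bound)
    ... | i , notAll = i , ¬∀⟶∃¬ _ _ (meet? i) notAll

module PathFamilies (G : Graph) (O : OrderedSubset G) where
  open OrderedSubset O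
  open Linkages G O hiding (_≤_)
  open OrderedIntervals isSTO
  open IsStrictTotalOrder isSTO using () renaming (trans to <-trans)

  Endpoint : ∀ {n} → Family n → L → Set
  Endpoint P x = ∃[ i ] (x ≡ left (P i) ⊎ x ≡ right (P i))

  endpoint∈verts : ∀ p {x} → x ≡ left p ⊎ x ≡ right p → ι x ∈ verts p
  endpoint∈verts p (inj₁ refl) = here refl
  endpoint∈verts p (inj₂ refl) = there (∈-++⁺ʳ (inner p) (here refl))

  -- Disjoint paths have distinct endpoints; this is what makes the left
  -- endpoints sortable and the interval ends of P and Q different.
  lefts-distinct : ∀ {n} (P : Family n) → IsLinkage P → ∀ a b → a ≢ b → left (P a) ≢ left (P b)
  lefts-distinct P linkage a b a≢b same =
    linkage a b a≢b _ (endpoint∈verts (P a) (inj₁ refl)) (endpoint∈verts (P b) (inj₁ same))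

  endpoints-distinct : ∀ {m n} (P : Family m) (Q : Family n) → IsLinkage (P ∪ Q) →
                       ∀ {x y} → Endpoint P x → Endpoint Q y → x ≢ y
  endpoints-distinct {m} {n} P Q linkage (a , x-end) (b , y-end) refl =
    linkage (a ↑ˡ n) (m ↑ʳ b) different _
      (subst (λ p → ι _ ∈ verts p) (sym P-part) (endpoint∈verts (P a) x-end))
      (subst (λ q → ι _ ∈ verts q) (sym Q-part) (endpoint∈verts (Q b) y-end))
    where
    P-part : (P ∪ Q) (a ↑ˡ n) ≡ P a
    P-part = cong [ P , Q ] (splitAt-↑ˡ m a n)
    Q-part : (P ∪ Q) (m ↑ʳ b) ≡ Q b
    Q-part = cong [ P , Q ] (splitAt-↑ʳ m n b)
    different : a ↑ˡ n ≢ m ↑ʳ b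
    different same with trans (sym (splitAt-↑ˡ m a n)) (trans (cong (splitAt m) same) (splitAt-↑ʳ m n b))
    ... | ()

  subfamily-pure : ∀ {k m} (P : Family m) (f : Fin k → Fin m) →
                   (∀ {a b} → f a ≡ f b → a ≡ b) → Pure P → Pure (P ∘ f)
  subfamily-pure P f f-injective = restrict
    where
    restrict-pairs : ∀ R → AllPairs R P → AllPairs R (P ∘ f)
    restrict-pairs R all i j i≢j = all (f i) (f j) (i≢j ∘ f-injective)
    restrict : Pure P → Pure (P ∘ f)
    restrict (inj₁ series) = inj₁ (restrict-pairs InSeries series)
    restrict (inj₂ (inj₁ nested)) = inj₂ (inj₁ (restrict-pairs Nested nested))
    restrict (inj₂ (inj₂ crossing)) = inj₂ (inj₂ (restrict-pairs Crossing crossing))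

  series-right : ∀ p q → InSeries p q → left p < left q → right p < left q
  series-right p q (inj₁ p<q) _ = p<q
  series-right p q (inj₂ q<p) lp<lq = ⊥-elim (<-asym lp<lq (<-trans (left<right q) q<p))

  nested-right : ∀ p q → Nested p q → left p < left q → right q < right p
  nested-right p q (inj₁ (_ , rq<rp)) _ = rq<rp
  nested-right p q (inj₂ (lq<lp , _)) lp<lq = ⊥-elim (<-asym lp<lq lq<lp)

  crossing-right : ∀ p q → Crossing p q → left p < left q → right p < right q
  crossing-right p q (inj₁ (_ , _ , rp<rq)) _ = rp<rq
  crossing-right p q (inj₂ (lq<lp , _)) lp<lq = ⊥-elim (<-asym lp<lq lq<lp)

  Interlaced : ∀ {n} → Family n → Set
  Interlaced P = ∀ a b → left (P a) < right (P b)

  nested-or-crossing⇒interlaced : ∀ {n} (P : Family n) → NestedL P ⊎ CrossingL P → Interlaced P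
  nested-or-crossing⇒interlaced P kind a b with a ≟ b
  ... | yes refl = left<right (P a)
  ... | no a≢b = interlace kind
    where
    interlace : NestedL P ⊎ CrossingL P → left (P a) < right (P b)
    interlace (inj₁ nested) with nested a b a≢b
    ... | inj₁ (la<lb , _) = <-trans la<lb (left<right (P b))
    ... | inj₂ (_ , ra<rb) = <-trans (left<right (P a)) ra<rb
    interlace (inj₂ crossing) with crossing a b a≢b
    ... | inj₁ (_ , _ , ra<rb) = <-trans (left<right (P a)) ra<rb
    ... | inj₂ (_ , la<rb , _) = la<rb

  interlaced⇒¬series : ∀ {n} {P : Family n} → Interlaced P → ∀ {a b} → a ≢ b → ¬ SeriesL P
  interlaced⇒¬series interlaced {a} {b} a≢b series with series a b a≢b
  ... | inj₁ ra<lb = <-asym ra<lb (interlaced b a)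
  ... | inj₂ rb<la = <-asym rb<la (interlaced a b)

  hull-within : ∀ {S : L → Set} {X} → (∀ x → S x → x ∈ᴵ X) → ∀ z → Hull S z → z ∈ᴵ X
  hull-within within z (x , y , Sx , Sy , x≤z , z≤y) =
    ≤-trans (proj₁ (within x Sx)) x≤z , ≤-trans z≤y (proj₂ (within y Sy))

  empty-hull : ∀ {S : L → Set} → (∀ {x} → ¬ S x) → ∀ (B : L → Set) → Disjoint (Hull S) B
  empty-hull nothing B z (x , _ , Sx , _) _ = nothing Sx

  disjoint-within : ∀ {A B : L → Set} {X Y} → (∀ z → A z → z ∈ᴵ X) → (∀ z → B z → z ∈ᴵ Y) →
                    (∀ z → z ∈ᴵ X → z ∈ᴵ Y → ⊥) → Disjoint A B
  disjoint-within A⊆X B⊆Y no-common z Az Bz = no-common z (A⊆X z Az) (B⊆Y z Bz)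

  disjoint-sym : ∀ {A B : L → Set} → Disjoint A B → Disjoint B A
  disjoint-sym A∩B z Bz Az = A∩B z Az Bz

  disjoint-∪ : ∀ {A B C : L → Set} → Disjoint A B → Disjoint A C → Disjoint A (B ∪ˢ C)
  disjoint-∪ A∩B A∩C z Az = [ A∩B z Az , A∩C z Az ]

  module Spans {s} (B : Family (suc s)) where
    minLeft maxLeft minRight maxRight : Fin (suc s)
    minLeft = proj₁ (argmin (left ∘ B))
    maxLeft = proj₁ (argmax (left ∘ B))
    minRight = proj₁ (argmin (right ∘ B))
    maxRight = proj₁ (argmax (right ∘ B))

    minLeft-≤ : ∀ k → left (B minLeft) ≤ left (B k)
    minLeft-≤ = proj₂ (argmin (left ∘ B))

    ≤-maxLeft : ∀ k → left (B k) ≤ left (B maxLeft)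
    ≤-maxLeft = proj₂ (argmax (left ∘ B))

    minRight-≤ : ∀ k → right (B minRight) ≤ right (B k)
    minRight-≤ = proj₂ (argmin (right ∘ B))

    ≤-maxRight : ∀ k → right (B k) ≤ right (B maxRight)
    ≤-maxRight = proj₂ (argmax (right ∘ B))

    leftSpan rightSpan span : Interval
    leftSpan = ⟦ left (B minLeft) , left (B maxLeft) ⟧
    rightSpan = ⟦ right (B minRight) , right (B maxRight) ⟧
    span = ⟦ left (B minLeft) , right (B maxRight) ⟧

    I⊆span : ∀ z → I B z → z ∈ᴵ span
    I⊆span = hull-within endpoint-within
      where
      endpoint-within : ∀ x → Endpoint B x → x ∈ᴵ span
      endpoint-within x (k , inj₁ refl) =
        minLeft-≤ k , ≤-trans (inj₁ (left<right (B k))) (≤-maxRight k)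
      endpoint-within x (k , inj₂ refl) =
        ≤-trans (minLeft-≤ k) (inj₁ (left<right (B k))) , ≤-maxRight k

    I-left⊆leftSpan : ∀ z → I-left B z → z ∈ᴵ leftSpan
    I-left⊆leftSpan = hull-within λ { x (k , refl) → minLeft-≤ k , ≤-maxLeft k }

    I-right⊆rightSpan : ∀ z → I-right B z → z ∈ᴵ rightSpan
    I-right⊆rightSpan = hull-within λ { x (k , refl) → minRight-≤ k , ≤-maxRight k }

  record BlockSpans {n} (P : Family n) (m w : ℕ) : Set where
    field
      spans : Fin m → Fin w → Interval
      separated : Separated spans
      ends-at-endpoint : ∀ i k → Endpoint P (hi (spans i k))
  open BlockSpans public

  disjoint-blocks : ∀ {nP nQ m a n b} {P : Family nP} {Q : Family nQ} → IsLinkage (P ∪ Q) →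
    (X : BlockSpans P (suc m) (suc a)) (Y : BlockSpans Q n (suc b)) →
    suc m * suc a + n * suc b ℕ.≤ suc m * n →
    ∃[ i ] ∃[ j ] (∀ k k′ z → z ∈ᴵ spans X i k → z ∈ᴵ spans Y j k′ → ⊥)
  disjoint-blocks {P = P} {Q} linkage X Y bound = no-common-points (blocks-avoid bound)
    where
    open BlockCounting (spans X) (spans Y) (separated X) (separated Y)
      (λ i p j q → endpoints-distinct P Q linkage (ends-at-endpoint X i p) (ends-at-endpoint Y j q))
    no-common-points : ∃[ i ] ∃[ j ] ¬ BlocksMeet i j →
      ∃[ i ] ∃[ j ] (∀ k k′ z → z ∈ᴵ spans X i k → z ∈ᴵ spans Y j k′ → ⊥)
    no-common-points (i , j , avoid) = i , j , λ k k′ z zX zY → avoid (k , k′ , common-point⇒overlap zX zY)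

  module Blocks {m s} (P : Family (m * suc s)) (linkage : IsLinkage P) where
    private
      sorting : Σ (Fin (m * suc s) → Fin (m * suc s))
                  λ σ → ∀ a b → a Fin.< b → left (P (σ a)) < left (P (σ b))
      sorting = sortedBy (m * suc s) (left ∘ P) (lefts-distinct P linkage)

    -- the k-th path of block i is the (i·(1 + s) + k)-th path from the left
    index : Fin m → Fin (suc s) → Fin (m * suc s)
    index i k = proj₁ sorting (combine i k)

    block : Fin m → Family (suc s)
    block i = P ∘ index i

    index-injective : ∀ {i k i′ k′} → index i k ≡ index i′ k′ → i ≡ i′ × k ≡ k′
    index-injective same =
      combine-injective _ _ _ _ (increasing⇒injective (left ∘ P) (proj₁ sorting) (proj₂ sorting) same)

    block-subfamily : ∀ i → SubFamily (block i) P
    block-subfamily i = index i , (λ same → proj₂ (index-injective same)) , λ _ → refl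

    block-pure : Pure P → ∀ i → Pure (block i)
    block-pure pure i = subfamily-pure P (index i) (λ same → proj₂ (index-injective same)) pure

    different-blocks : ∀ {i i′} → i ≢ i′ → ∀ k k′ → index i k ≢ index i′ k′
    different-blocks i≢i′ k k′ same = i≢i′ (proj₁ (index-injective same))

    across-blocks : ∀ R → AllPairs R P → ∀ {i i′} → i ≢ i′ → ∀ k k′ → R (block i k) (block i′ k′)
    across-blocks R all {i} {i′} i≢i′ k k′ = all (index i k) (index i′ k′) (different-blocks i≢i′ k k′)

    blocks-ordered : ∀ {i i′} → i Fin.< i′ → ∀ k k′ → left (block i k) < left (block i′ k′)
    blocks-ordered i<i′ k k′ = proj₂ sorting _ _ (combine-monoˡ-< k k′ i<i′)

    module Span (i : Fin m) = Spans (block i)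
    open Span public

    series-spans : SeriesL P → BlockSpans P m 1
    series-spans series = record
      { spans = λ i _ → span i
      ; separated = λ { i zero i′ zero different →
          apart-from-ordered span ordered i i′ (different ∘ cong (_, zero)) }
      ; ends-at-endpoint = λ i _ → index i (maxRight i) , inj₂ refl
      }
      where
      ordered : ∀ {i i′} → i Fin.< i′ → Apart (span i) (span i′)
      ordered {i} {i′} i<i′ = inj₁ (series-right (block i (maxRight i)) (block i′ (minLeft i′))
        (across-blocks InSeries series (<⇒≢ i<i′) (maxRight i) (minLeft i′))
        (blocks-ordered i<i′ (maxRight i) (minLeft i′)))

    lefts-ordered : ∀ {i i′} → i Fin.< i′ → Apart (leftSpan i) (leftSpan i′)
    lefts-ordered {i} {i′} i<i′ = inj₁ (blocks-ordered i<i′ (maxLeft i) (minLeft i′))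

    -- Nested blocks have their right spans in reverse order, crossing ones in order.
    rights-ordered : NestedL P ⊎ CrossingL P → ∀ {i i′} → i Fin.< i′ → Apart (rightSpan i) (rightSpan i′)
    rights-ordered (inj₁ nested) {i} {i′} i<i′ =
      inj₂ (nested-right (block i (minRight i)) (block i′ (maxRight i′))
        (across-blocks Nested nested (<⇒≢ i<i′) (minRight i) (maxRight i′))
        (blocks-ordered i<i′ (minRight i) (maxRight i′)))
    rights-ordered (inj₂ crossing) {i} {i′} i<i′ =
      inj₁ (crossing-right (block i (maxRight i)) (block i′ (minRight i′))
        (across-blocks Crossing crossing (<⇒≢ i<i′) (maxRight i) (minRight i′))
        (blocks-ordered i<i′ (maxRight i) (minRight i′)))

    left-before-right : NestedL P ⊎ CrossingL P → ∀ i i′ → hi (leftSpan i) < lo (rightSpan i′)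
    left-before-right kind i i′ =
      nested-or-crossing⇒interlaced P kind (index i (maxLeft i)) (index i′ (minRight i′))

    interlaced-spans : NestedL P ⊎ CrossingL P → BlockSpans P m 2
    interlaced-spans kind = record
      { spans = spans′
      ; separated = separated′
      ; ends-at-endpoint = λ { i zero → index i (maxLeft i) , inj₁ refl
                             ; i (suc zero) → index i (maxRight i) , inj₂ refl }
      }
      where
      spans′ : Fin m → Fin 2 → Interval
      spans′ i zero = leftSpan i
      spans′ i (suc zero) = rightSpan i

      separated′ : Separated spans′
      separated′ i zero i′ zero different =
        apart-from-ordered leftSpan lefts-ordered i i′ (different ∘ cong (_, zero))
      separated′ i zero i′ (suc zero) _ = inj₁ (left-before-right kind i i′)
      separated′ i (suc zero) i′ zero _ = inj₂ (left-before-right kind i′ i)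
      separated′ i (suc zero) i′ (suc zero) different =
        apart-from-ordered rightSpan (rights-ordered kind) i i′ (different ∘ cong (_, suc zero))

    not-series : ∀ {i i′} → i ≢ i′ → NestedL P ⊎ CrossingL P → ¬ SeriesL P
    not-series i≢i′ kind =
      interlaced⇒¬series {P = P} (nested-or-crossing⇒interlaced P kind) (different-blocks i≢i′ zero zero)

    left-right-disjoint : NestedL P ⊎ CrossingL P → ∀ i → Disjoint (I-left (block i)) (I-right (block i))
    left-right-disjoint kind i z zL zR =
      <⇒≱ (left-before-right kind i i)
          (≤-trans (proj₁ (I-right⊆rightSpan i z zR)) (proj₂ (I-left⊆leftSpan i z zL)))

module Main (G : Graph) (O : OrderedSubset G) where
  open Linkages G O hiding (_≤_)
  open PathFamilies G O

  Separation : ∀ {n t} → Family n → Family n → Family t → Family t → Set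
  Separation P Q P′ Q′ =
    (SeriesL P → SeriesL Q → Disjoint (I P′) (I Q′)) ×
    (SeriesL P → ¬ SeriesL Q → Disjoint (I P′) (I-left Q′ ∪ˢ I-right Q′)) ×
    (SeriesL Q → ¬ SeriesL P → Disjoint (I Q′) (I-left P′ ∪ˢ I-right P′)) ×
    (¬ SeriesL P → ¬ SeriesL Q →
      Disjoint (I-left P′) (I-right P′) × Disjoint (I-left P′) (I-left Q′) ×
      Disjoint (I-left P′) (I-right Q′) × Disjoint (I-right P′) (I-left Q′) ×
      Disjoint (I-right P′) (I-right Q′) × Disjoint (I-left Q′) (I-right Q′))

  Conclusion : (t : ℕ) → Family (4 * t) → Family (4 * t) → Set
  Conclusion t P Q = Σ (Family t) λ P′ → Σ (Family t) λ Q′ →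
    SubFamily P′ P × SubFamily Q′ Q × Pure P′ × Pure Q′ × Separation P Q P′ Q′

  no-paths : (P Q : Family 0) → Conclusion 0 P Q
  no-paths P Q =
    none , none , empty-sub P , empty-sub Q , inj₁ (λ ()) , inj₁ (λ ()) ,
    (λ _ _ → empty-hull nothing _) , (λ _ _ → empty-hull nothing _) ,
    (λ _ _ → empty-hull nothing _) ,
    λ _ _ → empty-hull nothing _ , empty-hull nothing _ , empty-hull nothing _ ,
            empty-hull nothing _ , empty-hull nothing _ , empty-hull nothing _
    where
    none : Family 0
    none ()
    empty-sub : ∀ {m} (R : Family m) → SubFamily none R
    empty-sub R = (λ ()) , (λ {}) , λ ()
    nothing : ∀ {A : Fin 0 → Set} → ¬ ∃ A
    nothing (() , _)

  module Cases {t} (P Q : Family (4 * suc t))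
    (linkageP : IsLinkage P) (linkageQ : IsLinkage Q) (linkage : IsLinkage (P ∪ Q))
    (pureP : Pure P) (pureQ : Pure Q) where
    module BP = Blocks {4} {t} P linkageP
    module BQ = Blocks {4} {t} Q linkageQ

    one : ∀ {n} → Fin (suc (suc n))
    one = suc zero

    zero≢one : ∀ {n} → zero ≢ one {n}
    zero≢one ()

    conclude : ∀ i j → Separation P Q (BP.block i) (BQ.block j) → Conclusion (suc t) P Q
    conclude i j separation =
      BP.block i , BQ.block j , BP.block-subfamily i , BQ.block-subfamily j ,
      BP.block-pure pureP i , BQ.block-pure pureQ j , separation

    series-series : SeriesL P → SeriesL Q → Conclusion (suc t) P Q
    series-series sP sQ =
      let i , j , avoid = disjoint-blocks linkage (BP.series-spans sP) (BQ.series-spans sQ) (ℕ.m≤m+n 8 8)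
      in conclude i j
           ( (λ _ _ → disjoint-within (BP.I⊆span i) (BQ.I⊆span j) (avoid zero zero))
           , (λ _ ¬sQ → ⊥-elim (¬sQ sQ)) , (λ _ ¬sP → ⊥-elim (¬sP sP)) , (λ ¬sP _ → ⊥-elim (¬sP sP)) )

    series-interlaced : SeriesL P → NestedL Q ⊎ CrossingL Q → Conclusion (suc t) P Q
    series-interlaced sP kQ =
      let i , j , avoid = disjoint-blocks linkage (BP.series-spans sP) (BQ.interlaced-spans kQ) (ℕ.m≤m+n 12 4)
      in conclude i j
           ( (λ _ sQ → ⊥-elim (BQ.not-series zero≢one kQ sQ))
           , (λ _ _ → disjoint-∪ (disjoint-within (BP.I⊆span i) (BQ.I-left⊆leftSpan j) (avoid zero zero))
                                 (disjoint-within (BP.I⊆span i) (BQ.I-right⊆rightSpan j) (avoid zero one)))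
           , (λ sQ _ → ⊥-elim (BQ.not-series zero≢one kQ sQ)) , (λ ¬sP _ → ⊥-elim (¬sP sP)) )

    interlaced-series : NestedL P ⊎ CrossingL P → SeriesL Q → Conclusion (suc t) P Q
    interlaced-series kP sQ =
      let i , j , avoid = disjoint-blocks linkage (BP.interlaced-spans kP) (BQ.series-spans sQ) (ℕ.m≤m+n 12 4)
      in conclude i j
           ( (λ sP _ → ⊥-elim (BP.not-series zero≢one kP sP))
           , (λ sP _ → ⊥-elim (BP.not-series zero≢one kP sP))
           , (λ _ _ → disjoint-∪
               (disjoint-sym (disjoint-within (BP.I-left⊆leftSpan i) (BQ.I⊆span j) (avoid zero zero)))
               (disjoint-sym (disjoint-within (BP.I-right⊆rightSpan i) (BQ.I⊆span j) (avoid one zero))))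
           , (λ _ ¬sQ → ⊥-elim (¬sQ sQ)) )

    interlaced-interlaced : NestedL P ⊎ CrossingL P → NestedL Q ⊎ CrossingL Q → Conclusion (suc t) P Q
    interlaced-interlaced kP kQ =
      let i , j , avoid = disjoint-blocks linkage (BP.interlaced-spans kP) (BQ.interlaced-spans kQ) ℕ.≤-refl
      in conclude i j
           ( (λ sP _ → ⊥-elim (BP.not-series zero≢one kP sP))
           , (λ sP _ → ⊥-elim (BP.not-series zero≢one kP sP))
           , (λ sQ _ → ⊥-elim (BQ.not-series zero≢one kQ sQ))
           , λ _ _ → BP.left-right-disjoint kP i
                   , disjoint-within (BP.I-left⊆leftSpan i) (BQ.I-left⊆leftSpan j) (avoid zero zero)
                   , disjoint-within (BP.I-left⊆leftSpan i) (BQ.I-right⊆rightSpan j) (avoid zero one)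
                   , disjoint-within (BP.I-right⊆rightSpan i) (BQ.I-left⊆leftSpan j) (avoid one zero)
                   , disjoint-within (BP.I-right⊆rightSpan i) (BQ.I-right⊆rightSpan j) (avoid one one)
                   , BQ.left-right-disjoint kQ j )

lemma26 : (t : ℕ) (G : Graph) (O : OrderedSubset G) →
    let open Linkages G O in
    (P Q : Family (4 * t)) →
    IsLinkage P → Pure P → IsLinkage Q → Pure Q → IsLinkage (P ∪ Q) →
    Σ (Family t) λ P' → Σ (Family t) λ Q' →
      SubFamily P' P × SubFamily Q' Q × Pure P' × Pure Q' ×
      (SeriesL P → SeriesL Q → Disjoint (I P') (I Q')) ×
      (SeriesL P → ¬ SeriesL Q → Disjoint (I P') (I-left Q' ∪ˢ I-right Q')) ×
      (SeriesL Q → ¬ SeriesL P → Disjoint (I Q') (I-left P' ∪ˢ I-right P')) ×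
      (¬ SeriesL P → ¬ SeriesL Q →
        Disjoint (I-left P') (I-right P') × Disjoint (I-left P') (I-left Q') ×
        Disjoint (I-left P') (I-right Q') × Disjoint (I-right P') (I-left Q') ×
        Disjoint (I-right P') (I-right Q') × Disjoint (I-left Q') (I-right Q'))
lemma26 zero G O P Q _ _ _ _ _ = Main.no-paths G O P Q
lemma26 (suc t) G O P Q linkageP pureP linkageQ pureQ linkage = by-purity pureP pureQ
  where
  open Linkages G O using (Pure)
  open Main G O using (Conclusion)
  open Main.Cases G O P Q linkageP linkageQ linkage pureP pureQ

  by-purity : Pure P → Pure Q → Conclusion (suc t) P Q
  by-purity (inj₁ sP) (inj₁ sQ) = series-series sP sQ
  by-purity (inj₁ sP) (inj₂ kQ) = series-interlaced sP kQ
  by-purity (inj₂ kP) (inj₁ sQ) = interlaced-series kP sQ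
  by-purity (inj₂ kP) (inj₂ kQ) = interlaced-interlaced kP kQ
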